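{- For every integer $n \geq 6$, $s(n)$ equals the number of partitions of $n$ with parts $q_1 \geq q_2 \geq \cdots \geq q_h$ such that (a) $h \geq 3$; (b) any two consecutive parts are either equal or differ by one, i.e. $q_j - q_{j+1} \in \{0,1\}$ for all $1 \leq j \leq h-1$; (c) the two largest parts are equal, $q_1 = q_2$; (d) the two smallest parts are both equal to $3$, $q_{h-1} = q_h = 3$.
   Context: For $n \geq 0$ let $q(n)$ be the number of partitions of $n$ into distinct parts, with $q(0)=1$, and set $q(-1)=q(-2)=0$. Define $s(n) = q(n) - 2q(n-1) + q(n-2)$ for $n \geq 0$. -}

module Defs where

open import Data.Nat using (ℕ; zero; suc; _∸_; _≤ᵇ_; _<ᵇ_; _≡ᵇ_)
open import Data.Bool using (Bool; true; false; _∧_; _∨_; if_then_else_)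
open import Data.List using (List; []; _∷_; [_]; map; concatMap; filter; length; downFrom; sum; reverse)
open import Data.Integer using (ℤ; +_; _-_; _+_; _*_)
open import Relation.Nullary.Decidable using (does)
open import Data.Bool.Properties using (T?)
open import Function using (_∘_)

-- genParts f n m : all non-increasing lists of positive integers, each ≤ m,
-- summing to n (fuel f ≥ n suffices, since each part is ≥ 1).
genParts : ℕ → ℕ → ℕ → List (List ℕ)
genParts _       zero    _ = [ [] ]
genParts zero    (suc n) _ = []
genParts (suc f) (suc n) m =
  concatMap (λ k → map (k ∷_) (genParts f (suc n ∸ k) k))
            (filter (λ k → T? ((1 ≤ᵇ k) ∧ (k ≤ᵇ m) ∧ (k ≤ᵇ suc n))) (downFrom (suc (suc n))))

partitions : ℕ → List (List ℕ)
partitions n = genParts n n n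

strictDec : List ℕ → Bool
strictDec (a ∷ b ∷ l) = (b <ᵇ a) ∧ strictDec (b ∷ l)
strictDec _ = true

q : ℕ → ℕ
q n = length (filter (λ l → T? (strictDec l)) (partitions n))

qShift : ℕ → ℕ → ℤ            -- qShift n k = q(n - k), 0 if n < k
qShift n zero = + q n
qShift zero (suc k) = + 0
qShift (suc n) (suc k) = qShift n k

s : ℕ → ℤ
s n = qShift n 0 - (+ 2) * qShift n 1 + qShift n 2

stepsOK : List ℕ → Bool
stepsOK (a ∷ b ∷ l) = ((a ≡ᵇ b) ∨ (a ≡ᵇ suc b)) ∧ stepsOK (b ∷ l)
stepsOK _ = true

topTwoEqual : List ℕ → Bool
topTwoEqual (a ∷ b ∷ _) = a ≡ᵇ b
topTwoEqual _ = false

bottomTwoThree : List ℕ → Bool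
bottomTwoThree l with reverse l
... | (a ∷ b ∷ _) = (a ≡ᵇ 3) ∧ (b ≡ᵇ 3)
... | _ = false

goodPartition : List ℕ → Bool
goodPartition l = (3 ≤ᵇ length l) ∧ stepsOK l ∧ topTwoEqual l ∧ bottomTwoThree l

countGood : ℕ → ℕ
countGood n = length (filter (λ l → T? (goodPartition l)) (partitions n))

-- Let D t be the generating function of partitions into exactly t distinct
-- parts; removing one from every part gives D (t+1) = x^(t+1) (D (t+1) + D t),
-- and q = Σ D t.  Put V t = (1 - x)(1 - x²) D t, which obeys the same
-- recursion with V 2 = x³.  On the other hand, for k ≥ 3 the partitions with
-- largest part k, consecutive parts differing by 0 or 1 and two smallest parts
-- equal to 3 satisfy this recursion too (removing the largest part leaves such
-- a partition with largest part k or k - 1), so their series is V k.  A good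
-- partition of n is t plus such a partition of n - t with largest part t, so
-- good partitions of n number Σ_{t ≥ 3} V t (n - t).  Writing Ψ = Σ x^t D t we
-- have q = (1 + x) Ψ, so (1 - x)² q = (1 - x)(1 - x²) Ψ = Σ x^t V t, and for
-- n ≥ 6 the terms t ≤ 2 of the last sum vanish at n.
module Submission where

open import Defs
open import Data.Nat using (ℕ; zero; suc; _≥_; _≤_; _<_; z≤n; s≤s; _∸_; _≤ᵇ_; _<ᵇ_; _≡ᵇ_; pred)
  renaming (_+_ to _+ℕ_)
import Data.Nat.Properties as ℕ
open import Data.Integer using (ℤ; +_; _+_; _-_; _*_; 0ℤ)
import Data.Integer.Properties as ℤ
open import Data.Integer.Tactic.RingSolver using (solve-∀)
open import Data.Bool using (Bool; true; false; if_then_else_; _∧_; _∨_; T)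
import Data.Bool.Properties as Bool
open import Data.Bool.Properties using (T?)
open import Data.List using (List; []; _∷_; [_]; map; concatMap; filter; length; downFrom; reverse; _++_)
import Data.List.Properties as List
open import Data.Unit using (tt)
open import Relation.Binary.PropositionalEquality hiding ([_])
open ≡-Reasoning

-- Formal power series

Series : Set
Series = ℕ → ℤ

-- shift k g is x^k g
shift : ℕ → Series → Series
shift zero    g n       = g n
shift (suc k) g zero    = 0ℤ
shift (suc k) g (suc n) = shift k g n

δ : Series
δ zero    = + 1
δ (suc n) = 0ℤ

shift-below : ∀ k g n → n < k → shift k g n ≡ 0ℤ
shift-below (suc k) g zero    _       = refl
shift-below (suc k) g (suc n) (s≤s p) = shift-below k g n p

shift-at : ∀ k g n → shift k g (k +ℕ n) ≡ g n
shift-at zero    g n = refl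
shift-at (suc k) g n = shift-at k g n

shift-cong : ∀ k {g h} n → (∀ i → g i ≡ h i) → shift k g n ≡ shift k h n
shift-cong zero    n       e = e n
shift-cong (suc k) zero    e = refl
shift-cong (suc k) (suc n) e = shift-cong k n e

shift-cong≤ : ∀ k {g h} n → (∀ i → i ≤ n → g i ≡ h i) → shift k g n ≡ shift k h n
shift-cong≤ zero    n       e = e n ℕ.≤-refl
shift-cong≤ (suc k) zero    e = refl
shift-cong≤ (suc k) (suc n) e = shift-cong≤ k n (λ i p → e i (ℕ.m≤n⇒m≤1+n p))

shift-zero : ∀ k {g} n → (∀ i → g i ≡ 0ℤ) → shift k g n ≡ 0ℤ
shift-zero zero    n       e = e n
shift-zero (suc k) zero    e = refl
shift-zero (suc k) (suc n) e = shift-zero k n e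

shift-vanishing : ∀ k {g} t n → (∀ m → m < t → g m ≡ 0ℤ) → n < t → shift k g n ≡ 0ℤ
shift-vanishing zero    t n       e p = e n p
shift-vanishing (suc k) t zero    e p = refl
shift-vanishing (suc k) t (suc n) e p = shift-vanishing k t n e (ℕ.<-trans (ℕ.n<1+n n) p)

shift-+ : ∀ k g h n → shift k (λ i → g i + h i) n ≡ shift k g n + shift k h n
shift-+ zero    g h n       = refl
shift-+ (suc k) g h zero    = refl
shift-+ (suc k) g h (suc n) = shift-+ k g h n

shift-sub : ∀ k g h n → shift k (λ i → g i - h i) n ≡ shift k g n - shift k h n
shift-sub zero    g h n       = refl
shift-sub (suc k) g h zero    = refl
shift-sub (suc k) g h (suc n) = shift-sub k g h n

shift-shift : ∀ a b g n → shift (a +ℕ b) g n ≡ shift a (shift b g) n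
shift-shift zero    b g n       = refl
shift-shift (suc a) b g zero    = refl
shift-shift (suc a) b g (suc n) = shift-shift a b g n

shift-shift-cong : ∀ a b c d g n → a +ℕ b ≡ c +ℕ d → shift a (shift b g) n ≡ shift c (shift d g) n
shift-shift-cong a b c d g n e = begin
  shift a (shift b g) n ≡⟨ shift-shift a b g n ⟨
  shift (a +ℕ b) g n    ≡⟨ cong (λ k → shift k g n) e ⟩
  shift (c +ℕ d) g n    ≡⟨ shift-shift c d g n ⟩
  shift c (shift d g) n ∎

shift-comm : ∀ a b g n → shift a (shift b g) n ≡ shift b (shift a g) n
shift-comm a b g n = shift-shift-cong a b b a g n (ℕ.+-comm a b)

<ᵇ-suc : ∀ k n → (k <ᵇ suc n) ≡ (k ≤ᵇ n)
<ᵇ-suc zero    n = refl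
<ᵇ-suc (suc k) n = refl

shift-if : ∀ k g n → shift k g n ≡ (if k ≤ᵇ n then g (n ∸ k) else 0ℤ)
shift-if zero    g n       = refl
shift-if (suc k) g zero    = refl
shift-if (suc k) g (suc n) rewrite <ᵇ-suc k n = shift-if k g n

sumPos : ℕ → (ℕ → ℤ) → ℤ
sumPos zero    h = 0ℤ
sumPos (suc m) h = sumPos m h + h (suc m)

sumUpTo : ℕ → (ℕ → ℤ) → ℤ
sumUpTo K h = h 0 + sumPos K h

sumBelow : ℕ → (ℕ → ℤ) → ℤ
sumBelow zero    h = 0ℤ
sumBelow (suc L) h = sumBelow L h + h L

sumPos-cong : ∀ m {h h′} → (∀ j → suc j ≤ m → h (suc j) ≡ h′ (suc j)) → sumPos m h ≡ sumPos m h′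
sumPos-cong zero    e = refl
sumPos-cong (suc m) e = cong₂ _+_ (sumPos-cong m (λ j p → e j (ℕ.m≤n⇒m≤1+n p))) (e m ℕ.≤-refl)

sumPos-zero : ∀ m {h} → (∀ j → suc j ≤ m → h (suc j) ≡ 0ℤ) → sumPos m h ≡ 0ℤ
sumPos-zero zero    e = refl
sumPos-zero (suc m) e = cong₂ _+_ (sumPos-zero m (λ j p → e j (ℕ.m≤n⇒m≤1+n p))) (e m ℕ.≤-refl)

interchange : ∀ w x y z → (w + x) + (y + z) ≡ (w + y) + (x + z)
interchange = solve-∀

sumPos-+ : ∀ m a b → sumPos m (λ j → a j + b j) ≡ sumPos m a + sumPos m b
sumPos-+ zero    a b = refl
sumPos-+ (suc m) a b = trans (cong (_+ (a (suc m) + b (suc m))) (sumPos-+ m a b))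
                             (interchange (sumPos m a) (sumPos m b) (a (suc m)) (b (suc m)))

sumPos-suc : ∀ K h → sumPos (suc K) h ≡ sumUpTo K (λ t → h (suc t))
sumPos-suc zero    h = ℤ.+-comm 0ℤ (h 1)
sumPos-suc (suc K) h = trans (cong (_+ h (suc (suc K))) (sumPos-suc K h)) (ℤ.+-assoc (h 1) _ _)

sumUpTo-cong : ∀ K {h h′} → (∀ t → h t ≡ h′ t) → sumUpTo K h ≡ sumUpTo K h′
sumUpTo-cong K e = cong₂ _+_ (e 0) (sumPos-cong K (λ j _ → e (suc j)))

Λ-form : ℤ → ℤ → ℤ → ℤ → ℤ
Λ-form a b c d = ((a - b) - c) + d

sumPos-Λ-form : ∀ K a b c d → sumPos K (λ t → Λ-form (a t) (b t) (c t) (d t))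
                            ≡ Λ-form (sumPos K a) (sumPos K b) (sumPos K c) (sumPos K d)
sumPos-Λ-form zero    a b c d = refl
sumPos-Λ-form (suc K) a b c d =
  trans (cong (_+ Λ-form (a (suc K)) (b (suc K)) (c (suc K)) (d (suc K))) (sumPos-Λ-form K a b c d))
        (additive (sumPos K a) (sumPos K b) (sumPos K c) (sumPos K d) (a (suc K)) (b (suc K)) (c (suc K)) (d (suc K)))
  where
  additive : ∀ w x y z a′ b′ c′ d′ → (((w - x) - y) + z) + (((a′ - b′) - c′) + d′) ≡ (((w + a′) - (x + b′)) - (y + c′)) + (z + d′)
  additive = solve-∀

sumUpTo-Λ-form : ∀ K a b c d → sumUpTo K (λ t → Λ-form (a t) (b t) (c t) (d t))
                              ≡ Λ-form (sumUpTo K a) (sumUpTo K b) (sumUpTo K c) (sumUpTo K d)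
sumUpTo-Λ-form K a b c d =
  trans (cong (λ z → Λ-form (a 0) (b 0) (c 0) (d 0) + z) (sumPos-Λ-form K a b c d))
        (additive (sumPos K a) (sumPos K b) (sumPos K c) (sumPos K d) (a 0) (b 0) (c 0) (d 0))
  where
  additive : ∀ w x y z a′ b′ c′ d′ → (((a′ - b′) - c′) + d′) + (((w - x) - y) + z) ≡ (((a′ + w) - (b′ + x)) - (c′ + y)) + (d′ + z)
  additive = solve-∀

shift-sumPos : ∀ k K (G : ℕ → Series) n → shift k (λ i → sumPos K (λ t → G t i)) n ≡ sumPos K (λ t → shift k (G t) n)
shift-sumPos zero    K G n       = refl
shift-sumPos (suc k) K G zero    = sym (sumPos-zero K (λ j _ → refl))
shift-sumPos (suc k) K G (suc n) = shift-sumPos k K G n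

shift-sumUpTo : ∀ k K (G : ℕ → Series) n → shift k (λ i → sumUpTo K (λ t → G t i)) n ≡ sumUpTo K (λ t → shift k (G t) n)
shift-sumUpTo k K G n = trans (shift-+ k (G 0) (λ i → sumPos K (λ t → G t i)) n)
                              (cong (λ z → shift k (G 0) n + z) (shift-sumPos k K G n))

-- Partitions into a given number of distinct parts

-- strictBounded m t n: partitions of n into t distinct parts, all ≤ m
strictBounded : ℕ → ℕ → Series
strictBounded zero    zero    n = δ n
strictBounded zero    (suc t) n = 0ℤ
strictBounded (suc m) zero    n = strictBounded m zero n
strictBounded (suc m) (suc t) n = strictBounded m (suc t) n + shift (suc m) (strictBounded m t) n

strictBounded-zero : ∀ m n → strictBounded m 0 n ≡ δ n
strictBounded-zero zero    n = refl
strictBounded-zero (suc m) n = strictBounded-zero m n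

strictBounded-at0 : ∀ m t → strictBounded m (suc t) 0 ≡ 0ℤ
strictBounded-at0 zero    t = refl
strictBounded-at0 (suc m) t = cong (_+ 0ℤ) (strictBounded-at0 m t)

-- Lowering every part by one: parts ≤ m + 1 become parts ≤ m, and a part 1 disappears.
strictBounded-lower : ∀ m t n → strictBounded (suc m) (suc t) n
                              ≡ shift (suc t) (strictBounded m (suc t)) n + shift (suc t) (strictBounded m t) n
strictBounded-lower zero zero n = cong (_+ shift 1 δ n) (sym (shift-zero 1 n (λ _ → refl)))
strictBounded-lower zero (suc t) n =
  trans (cong (_+_ 0ℤ) (shift-zero 1 n (λ _ → refl)))
        (sym (cong₂ _+_ (shift-zero (suc (suc t)) n (λ _ → refl)) (shift-zero (suc (suc t)) n (λ _ → refl))))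
strictBounded-lower (suc m) t n = begin
    strictBounded (suc m) (suc t) n + shift (suc (suc m)) (strictBounded (suc m) t) n
  ≡⟨ cong (_+ shift (suc (suc m)) (strictBounded (suc m) t) n) (strictBounded-lower m t n) ⟩
    (A + shift (suc t) (strictBounded m t) n) + shift (suc (suc m)) (strictBounded (suc m) t) n
  ≡⟨ ℤ.+-assoc A _ _ ⟩
    A + (shift (suc t) (strictBounded m t) n + shift (suc (suc m)) (strictBounded (suc m) t) n)
  ≡⟨ cong (_+_ A) (lowered-new-part t) ⟩
    A + (shift (suc t) (shift (suc m) (strictBounded m t)) n + shift (suc t) (strictBounded (suc m) t) n)
  ≡⟨ ℤ.+-assoc A _ _ ⟨
    (A + shift (suc t) (shift (suc m) (strictBounded m t)) n) + shift (suc t) (strictBounded (suc m) t) n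
  ≡⟨ cong (_+ shift (suc t) (strictBounded (suc m) t) n) (shift-+ (suc t) (strictBounded m (suc t)) (shift (suc m) (strictBounded m t)) n) ⟨
    shift (suc t) (strictBounded (suc m) (suc t)) n + shift (suc t) (strictBounded (suc m) t) n
  ∎
  where
  A : ℤ
  A = shift (suc t) (strictBounded m (suc t)) n
  lowered-new-part : ∀ t → shift (suc t) (strictBounded m t) n + shift (suc (suc m)) (strictBounded (suc m) t) n
                         ≡ shift (suc t) (shift (suc m) (strictBounded m t)) n + shift (suc t) (strictBounded (suc m) t) n
  lowered-new-part zero =
    trans (ℤ.+-comm (shift 1 (strictBounded m zero) n) _)
          (cong (_+ shift 1 (strictBounded (suc m) 0) n) (shift-shift 1 (suc m) (strictBounded m 0) n))
  lowered-new-part (suc t′) = begin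
      B + shift (suc (suc m)) (strictBounded (suc m) (suc t′)) n
    ≡⟨ cong (_+_ B) (shift-cong (suc (suc m)) n (strictBounded-lower m t′)) ⟩
      B + shift (suc (suc m)) (λ i → shift (suc t′) (strictBounded m (suc t′)) i + shift (suc t′) (strictBounded m t′) i) n
    ≡⟨ cong (_+_ B) (shift-+ (suc (suc m)) _ _ n) ⟩
      B + (shift (suc (suc m)) (shift (suc t′) (strictBounded m (suc t′))) n + shift (suc (suc m)) (shift (suc t′) (strictBounded m t′)) n)
    ≡⟨ cong₂ (λ u v → B + (u + v)) (regroup (strictBounded m (suc t′))) (regroup (strictBounded m t′)) ⟩
      B + (C + shift (suc (suc t′)) (shift (suc m) (strictBounded m t′)) n)
    ≡⟨ swap B C _ ⟩
      C + (B + shift (suc (suc t′)) (shift (suc m) (strictBounded m t′)) n)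
    ≡⟨ cong (_+_ C) (shift-+ (suc (suc t′)) (strictBounded m (suc t′)) (shift (suc m) (strictBounded m t′)) n) ⟨
      C + shift (suc (suc t′)) (strictBounded (suc m) (suc t′)) n
    ∎
    where
    B C : ℤ
    B = shift (suc (suc t′)) (strictBounded m (suc t′)) n
    C = shift (suc (suc t′)) (shift (suc m) (strictBounded m (suc t′))) n
    regroup : ∀ g → shift (suc (suc m)) (shift (suc t′) g) n ≡ shift (suc (suc t′)) (shift (suc m) g) n
    regroup g = shift-shift-cong (suc (suc m)) (suc t′) (suc (suc t′)) (suc m) g n
                  (cong suc (trans (ℕ.+-suc (suc m) t′) (cong suc (ℕ.+-comm (suc m) t′))))
    swap : ∀ a b c → a + (b + c) ≡ b + (a + c)
    swap = solve-∀

strictBounded-stable : ∀ m t n → n ≤ m → strictBounded (suc m) t n ≡ strictBounded m t n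
strictBounded-stable m zero    n p = refl
strictBounded-stable m (suc t) n p =
  trans (cong (_+_ (strictBounded m (suc t) n)) (shift-below (suc m) (strictBounded m t) n (s≤s p))) (ℤ.+-identityʳ _)

strict : ℕ → Series
strict t n = strictBounded n t n

strictBounded-large : ∀ m t n → n ≤ m → strictBounded m t n ≡ strict t n
strictBounded-large m t n p = trans (cong (λ z → strictBounded z t n) (sym (ℕ.m∸n+n≡m p))) (go (m ∸ n))
  where
  go : ∀ d → strictBounded (d +ℕ n) t n ≡ strict t n
  go zero    = refl
  go (suc d) = trans (strictBounded-stable (d +ℕ n) t n (ℕ.m≤n+m n d)) (go d)

strict-rec : ∀ t n → strict (suc t) n ≡ shift (suc t) (strict (suc t)) n + shift (suc t) (strict t) n
strict-rec t zero    = refl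
strict-rec t (suc m) =
  trans (strictBounded-lower m t (suc m))
        (cong₂ _+_ (shift-cong≤ t m (λ i p → strictBounded-large m (suc t) i p))
                   (shift-cong≤ t m (λ i p → strictBounded-large m t i p)))

strict-below : ∀ t n → n < suc t → strict (suc t) n ≡ 0ℤ
strict-below t n p = trans (strict-rec t n) (cong₂ _+_ (shift-below (suc t) _ n p) (shift-below (suc t) _ n p))

strict-0 : ∀ n → strict 0 (suc n) ≡ 0ℤ
strict-0 n = strictBounded-zero (suc n) (suc n)

strict-1 : ∀ n → strict 1 (suc n) ≡ + 1
strict-1 zero    = refl
strict-1 (suc n) = trans (strict-rec 0 (suc (suc n))) (cong₂ _+_ (strict-1 n) (strict-0 n))

-- Multiplication by (1 - x)(1 - x²) = 1 - x - x² + x³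

Λ : Series → Series
Λ g n = Λ-form (g n) (shift 1 g n) (shift 2 g n) (shift 3 g n)

Λ-cong : ∀ {g h} n → (∀ i → g i ≡ h i) → Λ g n ≡ Λ h n
Λ-cong n e = cong₂ _+_ (cong₂ _-_ (cong₂ _-_ (e n) (shift-cong 1 n e)) (shift-cong 2 n e)) (shift-cong 3 n e)

Λ-+ : ∀ g h n → Λ (λ i → g i + h i) n ≡ Λ g n + Λ h n
Λ-+ g h n =
  trans (cong₂ _+_ (cong₂ _-_ (cong (g n + h n -_) (shift-+ 1 g h n)) (shift-+ 2 g h n)) (shift-+ 3 g h n))
        (additive (g n) (h n) (shift 1 g n) (shift 1 h n) (shift 2 g n) (shift 2 h n) (shift 3 g n) (shift 3 h n))
  where
  additive : ∀ a b c d e f g h → (((a + b) - (c + d)) - (e + f)) + (g + h) ≡ (((a - c) - e) + g) + (((b - d) - f) + h)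
  additive = solve-∀

Λ-shift : ∀ k g n → shift k (Λ g) n ≡ Λ (shift k g) n
Λ-shift k g n = begin
    shift k (Λ g) n
  ≡⟨ shift-+ k _ _ n ⟩
    shift k (λ i → (g i - shift 1 g i) - shift 2 g i) n + shift k (shift 3 g) n
  ≡⟨ cong (_+ shift k (shift 3 g) n) (trans (shift-sub k _ _ n) (cong (_- shift k (shift 2 g) n) (shift-sub k _ _ n))) ⟩
    ((shift k g n - shift k (shift 1 g) n) - shift k (shift 2 g) n) + shift k (shift 3 g) n
  ≡⟨ cong₂ _+_ (cong₂ _-_ (cong (shift k g n -_) (shift-comm k 1 g n)) (shift-comm k 2 g n)) (shift-comm k 3 g n) ⟩
    Λ (shift k g) n
  ∎

reduced : ℕ → Series
reduced t = Λ (strict t)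

reduced-rec : ∀ t n → reduced (suc t) n ≡ shift (suc t) (reduced (suc t)) n + shift (suc t) (reduced t) n
reduced-rec t n =
  trans (Λ-cong n (strict-rec t))
        (trans (Λ-+ (shift (suc t) (strict (suc t))) (shift (suc t) (strict t)) n)
               (sym (cong₂ _+_ (Λ-shift (suc t) (strict (suc t)) n) (Λ-shift (suc t) (strict t) n))))

reduced-below : ∀ t n → n < suc t → reduced (suc t) n ≡ 0ℤ
reduced-below t n p
  rewrite strict-below t n p
        | shift-vanishing 1 (suc t) n (strict-below t) p
        | shift-vanishing 2 (suc t) n (strict-below t) p
        | shift-vanishing 3 (suc t) n (strict-below t) p = refl

reduced-0 : ∀ M → reduced 0 (4 +ℕ M) ≡ 0ℤ
reduced-0 M rewrite strict-0 (3 +ℕ M) | strict-0 (2 +ℕ M) | strict-0 (suc M) | strict-0 M = refl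

reduced-1 : ∀ M → reduced 1 (4 +ℕ M) ≡ 0ℤ
reduced-1 M rewrite strict-1 (3 +ℕ M) | strict-1 (2 +ℕ M) | strict-1 (suc M) | strict-1 M = refl

reduced-2 : ∀ M → reduced 2 (4 +ℕ M) ≡ 0ℤ
reduced-2 M
  rewrite strict-rec 1 (4 +ℕ M) | strict-rec 1 (3 +ℕ M) | strict-1 (suc M) | strict-1 M
  = cancel (strict 2 (2 +ℕ M)) (strict 2 (suc M))
  where
  cancel : ∀ a b → (((a + + 1) - (b + + 1)) - a) + b ≡ 0ℤ
  cancel = solve-∀

reduced-2≡x³ : ∀ n → reduced 2 n ≡ (if n ≡ᵇ 3 then + 1 else 0ℤ)
reduced-2≡x³ 0 = refl
reduced-2≡x³ 1 = refl
reduced-2≡x³ 2 = refl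
reduced-2≡x³ 3 = refl
reduced-2≡x³ (suc (suc (suc (suc M)))) = reduced-2 M

strictTotal : Series
strictTotal N = sumUpTo N (λ t → strict t N)

strictShiftedTotal : Series
strictShiftedTotal N = sumUpTo N (λ t → shift t (strict t) N)

strictTotal-suc : ∀ M → strictTotal (suc M) ≡ strictShiftedTotal (suc M) + strictShiftedTotal M
strictTotal-suc M = begin
    strict 0 (suc M) + sumPos (suc M) (λ t → strict t (suc M))
  ≡⟨ cong (_+_ (strict 0 (suc M))) (sumPos-cong (suc M) (λ j _ → strict-rec j (suc M))) ⟩
    strict 0 (suc M) + sumPos (suc M) (λ t → shift t (strict t) (suc M) + shift t (strict (pred t)) (suc M))
  ≡⟨ cong (_+_ (strict 0 (suc M))) (sumPos-+ (suc M) _ _) ⟩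
    strict 0 (suc M) + (sumPos (suc M) (λ t → shift t (strict t) (suc M)) + sumPos (suc M) (λ t → shift t (strict (pred t)) (suc M)))
  ≡⟨ ℤ.+-assoc (strict 0 (suc M)) _ _ ⟨
    strictShiftedTotal (suc M) + sumPos (suc M) (λ t → shift t (strict (pred t)) (suc M))
  ≡⟨ cong (_+_ (strictShiftedTotal (suc M))) (sumPos-suc M _) ⟩
    strictShiftedTotal (suc M) + strictShiftedTotal M
  ∎

strictShiftedTotal-extend : ∀ d M → sumUpTo (d +ℕ M) (λ t → shift t (strict t) M) ≡ strictShiftedTotal M
strictShiftedTotal-extend zero    M = refl
strictShiftedTotal-extend (suc d) M =
  trans (cong (λ z → strict 0 M + (sumPos (d +ℕ M) (λ t → shift t (strict t) M) + z))
              (shift-below (suc (d +ℕ M)) _ M (s≤s (ℕ.m≤n+m M d))))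
        (trans (cong (_+_ (strict 0 M)) (ℤ.+-identityʳ _)) (strictShiftedTotal-extend d M))

strictTotal-second-difference : ∀ M →
  (strictTotal (3 +ℕ M) - + 2 * strictTotal (2 +ℕ M)) + strictTotal (suc M)
  ≡ Λ-form (strictShiftedTotal (3 +ℕ M)) (strictShiftedTotal (2 +ℕ M)) (strictShiftedTotal (suc M)) (strictShiftedTotal M)
strictTotal-second-difference M
  rewrite strictTotal-suc (2 +ℕ M) | strictTotal-suc (suc M) | strictTotal-suc M
  = telescope (strictShiftedTotal (3 +ℕ M)) (strictShiftedTotal (2 +ℕ M)) (strictShiftedTotal (suc M)) (strictShiftedTotal M)
  where
  telescope : ∀ a b c d → ((a + b) - + 2 * (b + c)) + (c + d) ≡ ((a - b) - c) + d
  telescope = solve-∀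

sum-shifted-reduced : ∀ M → sumUpTo (3 +ℕ M) (λ t → shift t (reduced t) (3 +ℕ M))
  ≡ Λ-form (strictShiftedTotal (3 +ℕ M)) (strictShiftedTotal (2 +ℕ M)) (strictShiftedTotal (suc M)) (strictShiftedTotal M)
sum-shifted-reduced M = begin
    sumUpTo (3 +ℕ M) (λ t → shift t (reduced t) (3 +ℕ M))
  ≡⟨ sumUpTo-cong (3 +ℕ M) (λ t → Λ-shift t (strict t) (3 +ℕ M)) ⟩
    sumUpTo (3 +ℕ M) (λ t → Λ (shift t (strict t)) (3 +ℕ M))
  ≡⟨ sumUpTo-Λ-form (3 +ℕ M) (λ t → shift t (strict t) (3 +ℕ M)) (λ t → shift t (strict t) (2 +ℕ M))
                             (λ t → shift t (strict t) (suc M)) (λ t → shift t (strict t) M) ⟩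
    Λ-form (strictShiftedTotal (3 +ℕ M)) (sumUpTo (3 +ℕ M) (λ t → shift t (strict t) (2 +ℕ M)))
           (sumUpTo (3 +ℕ M) (λ t → shift t (strict t) (suc M))) (sumUpTo (3 +ℕ M) (λ t → shift t (strict t) M))
  ≡⟨ cong₂ _+_ (cong₂ _-_ (cong (strictShiftedTotal (3 +ℕ M) -_) (strictShiftedTotal-extend 1 (2 +ℕ M)))
                          (strictShiftedTotal-extend 2 (suc M)))
               (strictShiftedTotal-extend 3 M) ⟩
    Λ-form (strictShiftedTotal (3 +ℕ M)) (strictShiftedTotal (2 +ℕ M)) (strictShiftedTotal (suc M)) (strictShiftedTotal M)
  ∎

-- Counting partitions by their largest part

count : (List ℕ → Bool) → List (List ℕ) → ℕ
count p xs = length (filter (λ l → T? (p l)) xs)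

count-++ : ∀ p xs ys → count p (xs ++ ys) ≡ count p xs +ℕ count p ys
count-++ p xs ys = trans (cong length (List.filter-++ (λ l → T? (p l)) xs ys)) (List.length-++ (filter (λ l → T? (p l)) xs))

count-map-∷ : ∀ p k ys → count p (map (k ∷_) ys) ≡ count (λ l → p (k ∷ l)) ys
count-map-∷ p k [] = refl
count-map-∷ p k (y ∷ ys) with p (k ∷ y)
... | true  = cong suc (count-map-∷ p k ys)
... | false = count-map-∷ p k ys

count-cong : ∀ {p p′} xs → (∀ l → p l ≡ p′ l) → count p xs ≡ count p′ xs
count-cong [] e = refl
count-cong {p} {p′} (x ∷ xs) e with p x | p′ x | e x
... | true  | .true  | refl = cong suc (count-cong xs e)
... | false | .false | refl = count-cong xs e

count-false : ∀ xs → count (λ _ → false) xs ≡ 0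
count-false []       = refl
count-false (x ∷ xs) = count-false xs

count-∧ : ∀ b p xs → count (λ l → b ∧ p l) xs ≡ (if b then count p xs else 0)
count-∧ true  p xs = refl
count-∧ false p xs = count-false xs

count-[_] : ∀ p l → count p [ l ] ≡ (if p l then 1 else 0)
count-[ p ] l with p l
... | true  = refl
... | false = refl

+-if : ∀ b x → + (if b then x else 0) ≡ (if b then + x else 0ℤ)
+-if true  x = refl
+-if false x = refl

if-0 : ∀ b {x : ℤ} → x ≡ 0ℤ → (if b then x else 0ℤ) ≡ 0ℤ
if-0 true  e = e
if-0 false e = refl

if-if : ∀ b (x : ℤ) → (if b then (if b then x else 0ℤ) else 0ℤ) ≡ (if b then x else 0ℤ)
if-if true  x = refl
if-if false x = refl

≡ᵇ-refl : ∀ k → (k ≡ᵇ k) ≡ true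
≡ᵇ-refl zero    = refl
≡ᵇ-refl (suc k) = ≡ᵇ-refl k

>⇒≢ᵇ : ∀ j k → j < k → (k ≡ᵇ j) ≡ false
>⇒≢ᵇ zero    (suc k) p       = refl
>⇒≢ᵇ (suc j) (suc k) (s≤s p) = >⇒≢ᵇ j k p

<ᵇ-irrefl : ∀ m → (m <ᵇ m) ≡ false
<ᵇ-irrefl zero    = refl
<ᵇ-irrefl (suc m) = <ᵇ-irrefl m

<ᵇ-suc-self : ∀ m → (m <ᵇ suc m) ≡ true
<ᵇ-suc-self zero    = refl
<ᵇ-suc-self (suc m) = <ᵇ-suc-self m

<ᵇ-suc-≢ : ∀ c L → (L ≡ᵇ c) ≡ false → (c <ᵇ suc L) ≡ (c <ᵇ L)
<ᵇ-suc-≢ zero    zero    ()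
<ᵇ-suc-≢ zero    (suc L) e = refl
<ᵇ-suc-≢ (suc c) zero    e = refl
<ᵇ-suc-≢ (suc c) (suc L) e = <ᵇ-suc-≢ c L e

<⇒<ᵇ≡true : ∀ j m → j < m → (j <ᵇ m) ≡ true
<⇒<ᵇ≡true zero    (suc m) p       = refl
<⇒<ᵇ≡true (suc j) (suc m) (s≤s p) = <⇒<ᵇ≡true j m p

sumBelow-cong : ∀ L {h h′} → (∀ k → h k ≡ h′ k) → sumBelow L h ≡ sumBelow L h′
sumBelow-cong zero    e = refl
sumBelow-cong (suc L) e = cong₂ _+_ (sumBelow-cong L e) (e L)

sumBelow-zero : ∀ L {h} → (∀ k → h k ≡ 0ℤ) → sumBelow L h ≡ 0ℤ
sumBelow-zero zero    e = refl
sumBelow-zero (suc L) e = cong₂ _+_ (sumBelow-zero L e) (e L)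

sumBelow-+ : ∀ L a b → sumBelow L (λ j → a j + b j) ≡ sumBelow L a + sumBelow L b
sumBelow-+ zero    a b = refl
sumBelow-+ (suc L) a b = trans (cong (_+ (a L + b L)) (sumBelow-+ L a b)) (interchange (sumBelow L a) (sumBelow L b) (a L) (b L))

sumBelow-indicator : ∀ L c (v : ℕ → ℤ) → sumBelow L (λ k → if k ≡ᵇ c then v k else 0ℤ) ≡ (if c <ᵇ L then v c else 0ℤ)
sumBelow-indicator zero    c v = refl
sumBelow-indicator (suc L) c v with L ≡ᵇ c in e
... | true rewrite sym (ℕ.≡ᵇ⇒≡ L c (subst T (sym e) tt)) | sumBelow-indicator L L v | <ᵇ-irrefl L | <ᵇ-suc-self L
  = ℤ.+-identityˡ _
... | false rewrite <ᵇ-suc-≢ c L e | sumBelow-indicator L c v = ℤ.+-identityʳ _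

count-concatMap-filter : ∀ p (c : ℕ → Bool) (g : ℕ → List (List ℕ)) L →
  + count p (concatMap g (filter (λ k → T? (c k)) (downFrom L))) ≡ sumBelow L (λ k → if c k then + count p (g k) else 0ℤ)
count-concatMap-filter p c g zero = refl
count-concatMap-filter p c g (suc L) with c L
... | true  = trans (cong +_ (count-++ p (g L) _))
                    (trans (cong (λ z → + count p (g L) + z) (count-concatMap-filter p c g L))
                           (ℤ.+-comm (+ count p (g L)) (sumBelow L (λ k → if c k then + count p (g k) else 0ℤ))))
... | false = trans (count-concatMap-filter p c g L) (sym (ℤ.+-identityʳ _))

sumBelow-window : ∀ m N (g : ℕ → ℤ) →
  sumBelow (suc N) (λ k → if (1 ≤ᵇ k) ∧ (k ≤ᵇ m) ∧ (k ≤ᵇ N) then g k else 0ℤ) ≡ sumPos m (λ k → if k ≤ᵇ N then g k else 0ℤ)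
sumBelow-window zero    N g = sumBelow-zero (suc N) empty
  where
  empty : ∀ k → (if (1 ≤ᵇ k) ∧ (k ≤ᵇ 0) ∧ (k ≤ᵇ N) then g k else 0ℤ) ≡ 0ℤ
  empty zero    = refl
  empty (suc k) = refl
sumBelow-window (suc m) N g = begin
    sumBelow (suc N) (λ k → if (1 ≤ᵇ k) ∧ (k ≤ᵇ suc m) ∧ (k ≤ᵇ N) then g k else 0ℤ)
  ≡⟨ sumBelow-cong (suc N) split ⟩
    sumBelow (suc N) (λ k → window m k + (if k ≡ᵇ suc m then (if k ≤ᵇ N then g k else 0ℤ) else 0ℤ))
  ≡⟨ sumBelow-+ (suc N) _ _ ⟩
    sumBelow (suc N) (window m) + sumBelow (suc N) (λ k → if k ≡ᵇ suc m then (if k ≤ᵇ N then g k else 0ℤ) else 0ℤ)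
  ≡⟨ cong₂ _+_ (sumBelow-window m N g)
               (trans (sumBelow-indicator (suc N) (suc m) (λ k → if k ≤ᵇ N then g k else 0ℤ)) (if-if (m <ᵇ N) (g (suc m)))) ⟩
    sumPos (suc m) (λ k → if k ≤ᵇ N then g k else 0ℤ)
  ∎
  where
  window : ℕ → ℕ → ℤ
  window m k = if (1 ≤ᵇ k) ∧ (k ≤ᵇ m) ∧ (k ≤ᵇ N) then g k else 0ℤ
  peel : ∀ a m (B : Bool) (G : ℤ) → (if (a <ᵇ suc m) ∧ B then G else 0ℤ)
                                 ≡ (if (a <ᵇ m) ∧ B then G else 0ℤ) + (if a ≡ᵇ m then (if B then G else 0ℤ) else 0ℤ)
  peel zero    zero    true  G = sym (ℤ.+-identityˡ G)
  peel zero    zero    false G = refl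
  peel zero    (suc m) B     G = sym (ℤ.+-identityʳ _)
  peel (suc a) zero    B     G = refl
  peel (suc a) (suc m) B     G = peel a m B G
  split : ∀ k → window (suc m) k ≡ window m k + (if k ≡ᵇ suc m then (if k ≤ᵇ N then g k else 0ℤ) else 0ℤ)
  split zero    = refl
  split (suc a) = peel a m (suc a ≤ᵇ N) (g (suc a))

count-genParts : ∀ p f n m → + count p (genParts (suc f) (suc n) m)
  ≡ sumPos m (λ k → shift k (λ r → + count (λ l → p (k ∷ l)) (genParts f r k)) (suc n))
count-genParts p f n m = begin
    + count p (genParts (suc f) (suc n) m)
  ≡⟨ count-concatMap-filter p inRange (λ k → map (k ∷_) (genParts f (suc n ∸ k) k)) (suc (suc n)) ⟩
    sumBelow (suc (suc n)) (λ k → if inRange k then + count p (map (k ∷_) (genParts f (suc n ∸ k) k)) else 0ℤ)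
  ≡⟨ sumBelow-cong (suc (suc n)) (λ k → cong (λ z → if inRange k then + z else 0ℤ) (count-map-∷ p k (genParts f (suc n ∸ k) k))) ⟩
    sumBelow (suc (suc n)) (λ k → if inRange k then tail k (suc n ∸ k) else 0ℤ)
  ≡⟨ sumBelow-window m (suc n) (λ k → tail k (suc n ∸ k)) ⟩
    sumPos m (λ k → if k ≤ᵇ suc n then tail k (suc n ∸ k) else 0ℤ)
  ≡⟨ sumPos-cong m (λ j _ → sym (shift-if (suc j) (tail (suc j)) (suc n))) ⟩
    sumPos m (λ k → shift k (tail k) (suc n))
  ∎
  where
  inRange : ℕ → Bool
  inRange k = (1 ≤ᵇ k) ∧ (k ≤ᵇ m) ∧ (k ≤ᵇ suc n)
  tail : ℕ → Series
  tail k r = + count (λ l → p (k ∷ l)) (genParts f r k)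

count-genParts-head : ∀ {p p′} f r m → (∀ a l → p (a ∷ l) ≡ p′ (a ∷ l)) →
  count p (genParts f (suc r) m) ≡ count p′ (genParts f (suc r) m)
count-genParts-head zero r m e = refl
count-genParts-head {p} {p′} (suc f) r m e = go (filter (λ k → T? ((1 ≤ᵇ k) ∧ (k ≤ᵇ m) ∧ (k ≤ᵇ suc r))) (downFrom (suc (suc r))))
  where
  go : ∀ ks → count p (concatMap (λ k → map (k ∷_) (genParts f (suc r ∸ k) k)) ks)
            ≡ count p′ (concatMap (λ k → map (k ∷_) (genParts f (suc r ∸ k) k)) ks)
  go [] = refl
  go (k ∷ ks) =
    trans (count-++ p (map (k ∷_) (genParts f (suc r ∸ k) k)) _)
          (trans (cong₂ _+ℕ_ (trans (count-map-∷ p k ys) (trans (count-cong ys (e k)) (sym (count-map-∷ p′ k ys)))) (go ks))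
                 (sym (count-++ p′ (map (k ∷_) ys) _)))
    where ys = genParts f (suc r ∸ k) k

strictBoundedTotal : ℕ → ℕ → Series
strictBoundedTotal K m n = sumUpTo K (λ t → strictBounded m t n)

strictBoundedTotal-suc : ∀ K m n →
  strictBoundedTotal (suc K) (suc m) n ≡ strictBoundedTotal (suc K) m n + shift (suc m) (strictBoundedTotal K m) n
strictBoundedTotal-suc K m n = begin
    strictBounded m 0 n + sumPos (suc K) (λ t → strictBounded (suc m) t n)
  ≡⟨ cong (_+_ (strictBounded m 0 n))
          (sumPos-cong (suc K) {h′ = λ t → strictBounded m t n + shift (suc m) (strictBounded m (pred t)) n} (λ j _ → refl)) ⟩
    strictBounded m 0 n + sumPos (suc K) (λ t → strictBounded m t n + shift (suc m) (strictBounded m (pred t)) n)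
  ≡⟨ cong (_+_ (strictBounded m 0 n)) (sumPos-+ (suc K) _ _) ⟩
    strictBounded m 0 n + (sumPos (suc K) (λ t → strictBounded m t n) + sumPos (suc K) (λ t → shift (suc m) (strictBounded m (pred t)) n))
  ≡⟨ ℤ.+-assoc (strictBounded m 0 n) _ _ ⟨
    strictBoundedTotal (suc K) m n + sumPos (suc K) (λ t → shift (suc m) (strictBounded m (pred t)) n)
  ≡⟨ cong (_+_ (strictBoundedTotal (suc K) m n)) (trans (sumPos-suc K _) (sym (shift-sumUpTo (suc m) K strictBounded′ n))) ⟩
    strictBoundedTotal (suc K) m n + shift (suc m) (strictBoundedTotal K m) n
  ∎
  where
  strictBounded′ : ℕ → Series
  strictBounded′ t = strictBounded m t

strictBoundedTotal-by-largest : ∀ K m n →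
  strictBoundedTotal (suc K) m (suc n) ≡ sumPos m (λ j → shift j (strictBoundedTotal K (pred j)) (suc n))
strictBoundedTotal-by-largest K zero    n = trans (ℤ.+-identityˡ _) (sumPos-zero (suc K) (λ j _ → refl))
strictBoundedTotal-by-largest K (suc m) n =
  trans (strictBoundedTotal-suc K m (suc n))
        (cong (_+ shift (suc m) (strictBoundedTotal K m) (suc n)) (strictBoundedTotal-by-largest K m n))

strictBoundedTotal-at0 : ∀ K m → strictBoundedTotal K m 0 ≡ + 1
strictBoundedTotal-at0 K m = cong₂ _+_ (strictBounded-zero m 0) (sumPos-zero K (λ j _ → strictBounded-at0 m j))

count-strict-genParts : ∀ f K N m → N ≤ f → N ≤ K →
  + count (λ l → strictDec (suc m ∷ l)) (genParts f N (suc m)) ≡ strictBoundedTotal K m N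
count-strict-genParts f K zero m _ _ = sym (strictBoundedTotal-at0 K m)
count-strict-genParts (suc f) (suc K) (suc n) m (s≤s p) (s≤s q) = begin
    + count (λ l → strictDec (suc m ∷ l)) (genParts (suc f) (suc n) (suc m))
  ≡⟨ count-genParts (λ l → strictDec (suc m ∷ l)) f n (suc m) ⟩
    sumPos m (λ j → shift j (next j) (suc n)) + shift (suc m) (next (suc m)) (suc n)
  ≡⟨ cong₂ _+_ (sumPos-cong m (λ j j<m → shift-cong≤ j n (λ r r≤n → trans (smaller j r r≤n) (cong (λ b → if b then strictBoundedTotal K j r else 0ℤ) (<⇒<ᵇ≡true j m j<m)))))
               (trans (shift-cong≤ m n (λ r r≤n → trans (smaller m r r≤n) (cong (λ b → if b then strictBoundedTotal K m r else 0ℤ) (<ᵇ-irrefl m))))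
                      (shift-zero m n (λ _ → refl))) ⟩
    sumPos m (λ j → shift j (strictBoundedTotal K (pred j)) (suc n)) + 0ℤ
  ≡⟨ ℤ.+-identityʳ _ ⟩
    sumPos m (λ j → shift j (strictBoundedTotal K (pred j)) (suc n))
  ≡⟨ strictBoundedTotal-by-largest K m n ⟨
    strictBoundedTotal (suc K) m (suc n)
  ∎
  where
  next : ℕ → Series
  next k r = + count (λ l → strictDec (suc m ∷ k ∷ l)) (genParts f r k)
  smaller : ∀ j r → r ≤ n → next (suc j) r ≡ (if j <ᵇ m then strictBoundedTotal K j r else 0ℤ)
  smaller j r r≤n rewrite count-∧ (j <ᵇ m) (λ l → strictDec (suc j ∷ l)) (genParts f r (suc j)) with j <ᵇ m
  ... | true  = count-strict-genParts f K r j (ℕ.≤-trans r≤n p) (ℕ.≤-trans r≤n q)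
  ... | false = refl

q≡strictTotal : ∀ N → + q N ≡ strictTotal N
q≡strictTotal zero    = refl
q≡strictTotal (suc n) = begin
    + q (suc n)
  ≡⟨ count-genParts strictDec n n (suc n) ⟩
    sumPos (suc n) (λ k → shift k (λ r → + count (λ l → strictDec (k ∷ l)) (genParts n r k)) (suc n))
  ≡⟨ sumPos-cong (suc n) (λ j _ → shift-cong≤ j n (λ r r≤n → count-strict-genParts n n r j r≤n r≤n)) ⟩
    sumPos (suc n) (λ j → shift j (strictBoundedTotal n (pred j)) (suc n))
  ≡⟨ strictBoundedTotal-by-largest n (suc n) n ⟨
    strictTotal (suc n)
  ∎

-- Good partitions as chains

startsWith33 : List ℕ → Bool
startsWith33 (a ∷ b ∷ _) = (a ≡ᵇ 3) ∧ (b ≡ᵇ 3)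
startsWith33 _           = false

bottomTwoThree≡startsWith33∘reverse : ∀ l → bottomTwoThree l ≡ startsWith33 (reverse l)
bottomTwoThree≡startsWith33∘reverse l with reverse l
... | []        = refl
... | _ ∷ []    = refl
... | _ ∷ _ ∷ _ = refl

bottomTwoThree-∷ : ∀ k j a l → bottomTwoThree (k ∷ j ∷ a ∷ l) ≡ bottomTwoThree (j ∷ a ∷ l)
bottomTwoThree-∷ k j a l = begin
    bottomTwoThree (k ∷ j ∷ a ∷ l)
  ≡⟨ bottomTwoThree≡startsWith33∘reverse (k ∷ j ∷ a ∷ l) ⟩
    startsWith33 (reverse (k ∷ j ∷ a ∷ l))
  ≡⟨ cong startsWith33 (trans (List.unfold-reverse k (j ∷ a ∷ l)) (cong (_++ [ k ]) reverse-jal)) ⟩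
    startsWith33 (((reverse l ++ [ a ]) ++ [ j ]) ++ [ k ])
  ≡⟨ snoc-irrelevant (reverse l) ⟩
    startsWith33 ((reverse l ++ [ a ]) ++ [ j ])
  ≡⟨ cong startsWith33 reverse-jal ⟨
    startsWith33 (reverse (j ∷ a ∷ l))
  ≡⟨ bottomTwoThree≡startsWith33∘reverse (j ∷ a ∷ l) ⟨
    bottomTwoThree (j ∷ a ∷ l)
  ∎
  where
  reverse-jal : reverse (j ∷ a ∷ l) ≡ (reverse l ++ [ a ]) ++ [ j ]
  reverse-jal = trans (List.unfold-reverse j (a ∷ l)) (cong (_++ [ j ]) (List.unfold-reverse a l))
  snoc-irrelevant : ∀ zs → startsWith33 (((zs ++ [ a ]) ++ [ j ]) ++ [ k ]) ≡ startsWith33 ((zs ++ [ a ]) ++ [ j ])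
  snoc-irrelevant []           = refl
  snoc-irrelevant (z ∷ [])     = refl
  snoc-irrelevant (z ∷ z′ ∷ _) = refl

stepOK : ℕ → ℕ → Bool
stepOK k j = (k ≡ᵇ j) ∨ (k ≡ᵇ suc j)

isChain : ℕ → List ℕ → Bool
isChain k l = stepsOK (k ∷ l) ∧ bottomTwoThree (k ∷ l)

isChain-∷ : ∀ k j a l → isChain k (j ∷ a ∷ l) ≡ stepOK k j ∧ isChain j (a ∷ l)
isChain-∷ k j a l rewrite bottomTwoThree-∷ k j a l = Bool.∧-assoc (stepOK k j) _ _

goodPartition-∷ : ∀ t j l → goodPartition (t ∷ j ∷ l) ≡ (t ≡ᵇ j) ∧ isChain j l
goodPartition-∷ t j [] with t ≡ᵇ j
... | true  = refl
... | false = refl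
goodPartition-∷ t j (a ∷ l) rewrite bottomTwoThree-∷ t j a l with t ≡ᵇ j
... | true  = refl
... | false = Bool.∧-zeroʳ _

-- chains k N counts the lists l of weight N with isChain k l
chains : ℕ → Series
chains k N = if 3 ≤ᵇ k then reduced k (k +ℕ N) else 0ℤ

shift-unshift : ∀ t (g : Series) x → (∀ m → m < t → g m ≡ 0ℤ) → shift t (λ r → g (t +ℕ r)) x ≡ g x
shift-unshift zero    g x       e = refl
shift-unshift (suc t) g zero    e = sym (e 0 (s≤s z≤n))
shift-unshift (suc t) g (suc x) e = shift-unshift t (λ m → g (suc m)) x (λ m p → e (suc m) (s≤s p))

shift-chains : ∀ t x → shift t (chains t) x ≡ (if 3 ≤ᵇ t then reduced t x else 0ℤ)
shift-chains 0 x = refl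
shift-chains 1 x = shift-zero 1 x (λ _ → refl)
shift-chains 2 x = shift-zero 2 x (λ _ → refl)
shift-chains (suc (suc (suc t))) x = shift-unshift (3 +ℕ t) (reduced (3 +ℕ t)) x (λ m p → reduced-below (2 +ℕ t) m p)

chains-at0 : ∀ k → chains k 0 ≡ 0ℤ
chains-at0 0 = refl
chains-at0 1 = refl
chains-at0 2 = refl
chains-at0 (suc (suc (suc t))) =
  trans (reduced-rec (2 +ℕ t) (3 +ℕ t +ℕ 0))
        (cong₂ _+_ (trans (shift-at (3 +ℕ t) (reduced (3 +ℕ t)) 0) (reduced-below (2 +ℕ t) 0 (s≤s z≤n)))
                   (trans (shift-at (3 +ℕ t) (reduced (2 +ℕ t)) 0) (reduced-below (suc t) 0 (s≤s z≤n))))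

lastPair : ℕ → ℕ → Series
lastPair k j zero    = if (k ≡ᵇ 3) ∧ (j ≡ᵇ 3) then + 1 else 0ℤ
lastPair k j (suc r) = 0ℤ

chainsAfter : ℕ → ℕ → Series
chainsAfter k j r = (if stepOK k j then chains j r else 0ℤ) + lastPair k j r

lastPair-≢ : ∀ k j r → ((k ≡ᵇ 3) ∧ (j ≡ᵇ 3)) ≡ false → lastPair k j r ≡ 0ℤ
lastPair-≢ k j zero    e rewrite e = refl
lastPair-≢ k j (suc r) e = refl

lastPair-big : ∀ k j r → lastPair (4 +ℕ k) j r ≡ 0ℤ
lastPair-big k j zero    = refl
lastPair-big k j (suc r) = refl

shift3-lastPair33 : ∀ N → shift 3 (lastPair 3 3) N ≡ (if N ≡ᵇ 3 then + 1 else 0ℤ)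
shift3-lastPair33 0 = refl
shift3-lastPair33 1 = refl
shift3-lastPair33 2 = refl
shift3-lastPair33 3 = refl
shift3-lastPair33 (suc (suc (suc (suc N)))) = refl

chainsAfter-at0 : ∀ k j → (if (stepOK k j ∧ true) ∧ ((j ≡ᵇ 3) ∧ (k ≡ᵇ 3)) then + 1 else 0ℤ) ≡ chainsAfter k j 0
chainsAfter-at0 k j rewrite chains-at0 j with k ≡ᵇ 3 in k≡3 | j ≡ᵇ 3 in j≡3 | stepOK k j in ok
... | true  | true  | true  = refl
... | true  | true  | false rewrite ℕ.≡ᵇ⇒≡ k 3 (subst T (sym k≡3) tt) | ℕ.≡ᵇ⇒≡ j 3 (subst T (sym j≡3) tt) with ok
...   | ()
chainsAfter-at0 k j | true  | false | true  = refl
chainsAfter-at0 k j | true  | false | false = refl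
chainsAfter-at0 k j | false | true  | true  = refl
chainsAfter-at0 k j | false | true  | false = refl
chainsAfter-at0 k j | false | false | true  = refl
chainsAfter-at0 k j | false | false | false = refl

chains-by-next : ∀ k n → sumPos k (λ j → shift j (chainsAfter k j) (suc n)) ≡ chains k (suc n)
chains-by-next 0 n = refl
chains-by-next 1 n = cong (λ z → 0ℤ + (0ℤ + z)) (lastPair-≢ 1 1 n refl)
chains-by-next 2 n =
  cong₂ _+_ (cong (λ z → 0ℤ + (0ℤ + z)) (lastPair-≢ 2 1 n refl))
            (shift-zero 2 (suc n) (λ r → cong (_+_ 0ℤ) (lastPair-≢ 2 2 r refl)))
chains-by-next 3 n = begin
    (0ℤ + (0ℤ + lastPair 3 1 n)) + shift 2 (chainsAfter 3 2) (suc n) + shift 3 (chainsAfter 3 3) (suc n)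
  ≡⟨ cong₂ (λ u v → u + v + shift 3 (chainsAfter 3 3) (suc n))
           (cong (λ z → 0ℤ + (0ℤ + z)) (lastPair-≢ 3 1 n refl))
           (shift-zero 2 (suc n) (λ r → cong (_+_ 0ℤ) (lastPair-≢ 3 2 r refl))) ⟩
    0ℤ + shift 3 (chainsAfter 3 3) (suc n)
  ≡⟨ ℤ.+-identityˡ _ ⟩
    shift 3 (λ r → chains 3 r + lastPair 3 3 r) (suc n)
  ≡⟨ shift-+ 3 (chains 3) (lastPair 3 3) (suc n) ⟩
    shift 3 (chains 3) (suc n) + shift 3 (lastPair 3 3) (suc n)
  ≡⟨ cong₂ _+_ (shift-chains 3 (suc n)) (shift3-lastPair33 (suc n)) ⟩
    reduced 3 (suc n) + (if suc n ≡ᵇ 3 then + 1 else 0ℤ)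
  ≡⟨ cong₂ _+_ (shift-at 3 (reduced 3) (suc n)) (trans (shift-at 3 (reduced 2) (suc n)) (reduced-2≡x³ (suc n))) ⟨
    shift 3 (reduced 3) (3 +ℕ suc n) + shift 3 (reduced 2) (3 +ℕ suc n)
  ≡⟨ reduced-rec 2 (3 +ℕ suc n) ⟨
    chains 3 (suc n)
  ∎
chains-by-next (suc (suc (suc (suc k′)))) n = begin
    sumPos (2 +ℕ k′) h + h (3 +ℕ k′) + h k
  ≡⟨ cong₂ (λ u v → u + v + h k) (sumPos-zero (2 +ℕ k′) (λ j p → shift-zero (suc j) N (λ r → too-small j r p))) next-is-k-1 ⟩
    0ℤ + reduced (3 +ℕ k′) N + h k
  ≡⟨ cong₂ _+_ (ℤ.+-identityˡ (reduced (3 +ℕ k′) N)) next-is-k ⟩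
    reduced (3 +ℕ k′) N + reduced k N
  ≡⟨ ℤ.+-comm (reduced (3 +ℕ k′) N) (reduced k N) ⟩
    reduced k N + reduced (3 +ℕ k′) N
  ≡⟨ cong₂ _+_ (shift-at k (reduced k) N) (shift-at k (reduced (3 +ℕ k′)) N) ⟨
    shift k (reduced k) (k +ℕ N) + shift k (reduced (3 +ℕ k′)) (k +ℕ N)
  ≡⟨ reduced-rec (3 +ℕ k′) (k +ℕ N) ⟨
    chains k N
  ∎
  where
  k N : ℕ
  k = 4 +ℕ k′
  N = suc n
  h : ℕ → ℤ
  h j = shift j (chainsAfter k j) N
  chainsAfter-step : ∀ j → stepOK k j ≡ true → ∀ r → chainsAfter k j r ≡ chains j r
  chainsAfter-step j ok r rewrite ok | lastPair-big k′ j r = ℤ.+-identityʳ _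
  too-small : ∀ j r → suc j ≤ 2 +ℕ k′ → chainsAfter k (suc j) r ≡ 0ℤ
  too-small j r p
    rewrite >⇒≢ᵇ (suc j) k (s≤s (ℕ.m≤n⇒m≤1+n p)) | >⇒≢ᵇ (2 +ℕ j) k (s≤s (s≤s p))
    = trans (ℤ.+-identityˡ _) (lastPair-big k′ (suc j) r)
  next-is-k-1 : h (3 +ℕ k′) ≡ reduced (3 +ℕ k′) N
  next-is-k-1 = trans (shift-cong (3 +ℕ k′) N (chainsAfter-step (3 +ℕ k′) ok)) (shift-chains (3 +ℕ k′) N)
    where
    ok : stepOK k (3 +ℕ k′) ≡ true
    ok rewrite >⇒≢ᵇ k′ (suc k′) (ℕ.n<1+n k′) | ≡ᵇ-refl k′ = refl
  next-is-k : h k ≡ reduced k N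
  next-is-k = trans (shift-cong k N (chainsAfter-step k ok)) (shift-chains k N)
    where
    ok : stepOK k k ≡ true
    ok rewrite ≡ᵇ-refl k′ = refl

count-chains-genParts : ∀ f N k → N ≤ f → + count (isChain k) (genParts f N k) ≡ chains k N
count-chains-genParts f zero k _ = sym (chains-at0 k)
count-chains-genParts (suc f) (suc n) k (s≤s p) = begin
    + count (isChain k) (genParts (suc f) (suc n) k)
  ≡⟨ count-genParts (isChain k) f n k ⟩
    sumPos k (λ j → shift j (λ r → + count (λ l → isChain k (j ∷ l)) (genParts f r j)) (suc n))
  ≡⟨ sumPos-cong k (λ j _ → shift-cong≤ j n (λ r r≤n → next (suc j) r r≤n)) ⟩
    sumPos k (λ j → shift j (chainsAfter k j) (suc n))
  ≡⟨ chains-by-next k n ⟩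
    chains k (suc n)
  ∎
  where
  next : ∀ j r → r ≤ n → + count (λ l → isChain k (j ∷ l)) (genParts f r j) ≡ chainsAfter k j r
  next j zero _ = trans (cong +_ (count-[ (λ l → isChain k (j ∷ l)) ] [])) (trans (+-if _ 1) (chainsAfter-at0 k j))
  next j (suc r) r≤n = begin
      + count (λ l → isChain k (j ∷ l)) (genParts f (suc r) j)
    ≡⟨ cong +_ (count-genParts-head f r j (isChain-∷ k j)) ⟩
      + count (λ l → stepOK k j ∧ isChain j l) (genParts f (suc r) j)
    ≡⟨ cong +_ (count-∧ (stepOK k j) (isChain j) (genParts f (suc r) j)) ⟩
      + (if stepOK k j then count (isChain j) (genParts f (suc r) j) else 0)
    ≡⟨ +-if (stepOK k j) _ ⟩
      (if stepOK k j then + count (isChain j) (genParts f (suc r) j) else 0ℤ)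
    ≡⟨ cong (λ z → if stepOK k j then z else 0ℤ) (count-chains-genParts f (suc r) j (ℕ.≤-trans r≤n p)) ⟩
      (if stepOK k j then chains j (suc r) else 0ℤ)
    ≡⟨ ℤ.+-identityʳ _ ⟨
      chainsAfter k j (suc r)
    ∎

countGood-by-top : ∀ n → + countGood (2 +ℕ n)
  ≡ sumPos (2 +ℕ n) (λ t → shift t (λ r → if 3 ≤ᵇ t then reduced t r else 0ℤ) (2 +ℕ n))
countGood-by-top n =
  trans (count-genParts goodPartition (suc n) (suc n) (2 +ℕ n))
        (sumPos-cong (2 +ℕ n) (λ t _ → shift-cong≤ t (suc n) (λ r r≤ → below-top t r r≤)))
  where
  below-top : ∀ t r → r ≤ suc n →
    + count (λ l → goodPartition (suc t ∷ l)) (genParts (suc n) r (suc t)) ≡ (if 3 ≤ᵇ suc t then reduced (suc t) r else 0ℤ)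
  below-top t zero    _ = sym (if-0 (3 ≤ᵇ suc t) (reduced-below t 0 (s≤s z≤n)))
  below-top t (suc r) (s≤s r≤n) = begin
      + count (λ l → goodPartition (suc t ∷ l)) (genParts (suc n) (suc r) (suc t))
    ≡⟨ count-genParts (λ l → goodPartition (suc t ∷ l)) n r (suc t) ⟩
      sumPos (suc t) (λ j → shift j (λ r′ → + count (λ l → goodPartition (suc t ∷ j ∷ l)) (genParts n r′ j)) (suc r))
    ≡⟨ sumPos-cong (suc t) (λ j _ → shift-cong≤ j r (λ r′ r′≤ → second j r′ (ℕ.≤-trans r′≤ r≤n))) ⟩
      sumPos t secondEqual + secondEqual (suc t)
    ≡⟨ cong₂ _+_ (sumPos-zero t (λ j j<t → shift-zero (suc j) (suc r) (λ r′ → cong (λ b → if b then chains (suc j) r′ else 0ℤ) (>⇒≢ᵇ j t j<t))))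
                 (shift-cong (suc t) (suc r) (λ r′ → cong (λ b → if b then chains (suc t) r′ else 0ℤ) (≡ᵇ-refl t))) ⟩
      0ℤ + shift (suc t) (chains (suc t)) (suc r)
    ≡⟨ trans (ℤ.+-identityˡ _) (shift-chains (suc t) (suc r)) ⟩
      (if 3 ≤ᵇ suc t then reduced (suc t) (suc r) else 0ℤ)
    ∎
    where
    secondEqual : ℕ → ℤ
    secondEqual j = shift j (λ r′ → if suc t ≡ᵇ j then chains j r′ else 0ℤ) (suc r)
    second : ∀ j r′ → r′ ≤ n →
      + count (λ l → goodPartition (suc t ∷ suc j ∷ l)) (genParts n r′ (suc j)) ≡ (if t ≡ᵇ j then chains (suc j) r′ else 0ℤ)
    second j r′ r′≤n = begin
        + count (λ l → goodPartition (suc t ∷ suc j ∷ l)) (genParts n r′ (suc j))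
      ≡⟨ cong +_ (count-cong (genParts n r′ (suc j)) (goodPartition-∷ (suc t) (suc j))) ⟩
        + count (λ l → (t ≡ᵇ j) ∧ isChain (suc j) l) (genParts n r′ (suc j))
      ≡⟨ cong +_ (count-∧ (t ≡ᵇ j) (isChain (suc j)) (genParts n r′ (suc j))) ⟩
        + (if t ≡ᵇ j then count (isChain (suc j)) (genParts n r′ (suc j)) else 0)
      ≡⟨ +-if (t ≡ᵇ j) _ ⟩
        (if t ≡ᵇ j then + count (isChain (suc j)) (genParts n r′ (suc j)) else 0ℤ)
      ≡⟨ cong (λ z → if t ≡ᵇ j then z else 0ℤ) (count-chains-genParts n r′ (suc j) r′≤n) ⟩
        (if t ≡ᵇ j then chains (suc j) r′ else 0ℤ)
      ∎

sum-shifted-reduced-from3 : ∀ M → sumUpTo (6 +ℕ M) (λ t → shift t (reduced t) (6 +ℕ M))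
  ≡ sumPos (6 +ℕ M) (λ t → shift t (λ r → if 3 ≤ᵇ t then reduced t r else 0ℤ) (6 +ℕ M))
sum-shifted-reduced-from3 M =
  trans (cong (_+ sumPos (6 +ℕ M) (λ t → shift t (reduced t) (6 +ℕ M))) (reduced-0 (2 +ℕ M)))
        (trans (ℤ.+-identityˡ _) (sumPos-cong (6 +ℕ M) small))
  where
  small : ∀ j → suc j ≤ 6 +ℕ M → shift (suc j) (reduced (suc j)) (6 +ℕ M)
                                 ≡ shift (suc j) (λ r → if 3 ≤ᵇ suc j then reduced (suc j) r else 0ℤ) (6 +ℕ M)
  small zero          _ = reduced-1 (suc M)
  small (suc zero)    _ = reduced-2 M
  small (suc (suc j)) _ = refl

corollary1p6 : (n : ℕ) → n ≥ 6 → s n ≡ + countGood n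
corollary1p6 _ (s≤s (s≤s (s≤s (s≤s (s≤s (s≤s (z≤n {M}))))))) = begin
    s N
  ≡⟨ cong₂ (λ a b → (a - + 2 * b) + + q (4 +ℕ M)) (q≡strictTotal N) (q≡strictTotal (5 +ℕ M)) ⟩
    (strictTotal N - + 2 * strictTotal (5 +ℕ M)) + + q (4 +ℕ M)
  ≡⟨ cong (_+_ (strictTotal N - + 2 * strictTotal (5 +ℕ M))) (q≡strictTotal (4 +ℕ M)) ⟩
    (strictTotal N - + 2 * strictTotal (5 +ℕ M)) + strictTotal (4 +ℕ M)
  ≡⟨ strictTotal-second-difference (3 +ℕ M) ⟩
    Λ-form (strictShiftedTotal N) (strictShiftedTotal (5 +ℕ M)) (strictShiftedTotal (4 +ℕ M)) (strictShiftedTotal (3 +ℕ M))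
  ≡⟨ sum-shifted-reduced (3 +ℕ M) ⟨
    sumUpTo N (λ t → shift t (reduced t) N)
  ≡⟨ sum-shifted-reduced-from3 M ⟩
    sumPos N (λ t → shift t (λ r → if 3 ≤ᵇ t then reduced t r else 0ℤ) N)
  ≡⟨ countGood-by-top (4 +ℕ M) ⟨
    + countGood N
  ∎
  where
  N : ℕ
  N = 6 +ℕ M
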